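{- Let $T$ be a based scheme on $X$, $U$ a based scheme on $Y$, $\tau=\tau_T$, and $\zeta$ an action of $U$ on $T$. As $u$ ranges over $U$ and $t$ over $\tau$, the sets $[u,t]$ form a partition of $(Y\times X)\times(Y\times X)$.
   Context: All schemes are association schemes on finite sets. Complex product $pq=\{r:a_{pqr}>0\}$; closed: $T'^*T'\subseteq T'$; normal: $pT'=T'p$ for all $p$. For closed $T'$: $xT'=\bigcup_{t\in T'}xt$, $X/T'=\{xT'\}$, $t^{T'}=\{(x_1T',x_2T'):(x_1',x_2')\in t$ for some $x_i'\in x_iT'\}$, $T/\!\!/T'=\{t^{T'}\}$. Morphisms of schemes: maps of points preserving "same relation"; isomorphisms bijective on points and relations. Based schemes carry basepoints; based morphisms preserve them. Category $\mathcal C$: $\phi\in\mathrm{Hom}_{\mathcal C}(T,U)$ is $(T_\phi,U_\phi,\tilde\phi)$, $T_\phi,U_\phi$ normal closed, $\tilde\phi:T/\!\!/T_\phi\to U/\!\!/U_\phi$ a based isomorphism. Composition with $\psi\in\mathrm{Hom}_{\mathcal C}(U,V)$ ($V$ on $W$): $T_{\phi\psi}=\{t:\exists u,\ t^{T_\phi}\tilde\phi=u^{U_\phi},\ u^{U_\psi}\tilde\psi=1_W^{V_\psi}\}$, $V_{\phi\psi}=\{v:\exists u,\ 1_X^{T_\phi}\tilde\phi=u^{U_\phi},\ u^{U_\psi}\tilde\psi=v^{V_\psi}\}$, $(xT_{\phi\psi})\widetilde{\phi\psi}=wV_{\phi\psi}$ with $(xT_\phi)\tilde\phi=yU_\phi$,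 $(yU_\psi)\tilde\psi=wV_\psi$. $\mathrm{id}_T=(\{1_X\},\{1_X\},\mathrm{id})$. $\phi\le\psi$: $T_\phi\subseteq T_\psi$, $U_\phi\subseteq U_\psi$, $(xT_\phi)\tilde\phi\subseteq(xT_\psi)\tilde\psi$ for all $x$. $\phi^*$: same subsets, isomorphism $\tilde\phi^{ -1}$. $\tau=\tau_T$: the set $T$ with involution, distinguished $1=1_X$, constants $a_{pqr}$. A $\tau$-scheme: $(T',\alpha)$, $\alpha:\tau\to T'$ bijective, $1\alpha$ diagonal, $(p^*)\alpha=(p\alpha)^*$, $a_{(p\alpha)(q\alpha)(r\alpha)}=a_{pqr}$. For $\tau$-schemes $(T_1,\alpha),(T_2,\beta)$, $\phi\in\mathrm{Hom}_{\mathcal C}(T_1,T_2)$: $\phi(\tau)(P)=\{u:(t\alpha)^{(T_1)_\phi}\tilde\phi=(u\beta)^{(T_2)_\phi}$ for some $t\in P\}$. Action $\zeta$ of $U$ ($Y$, basepoint $y_*$) on $T$ ($X$): $\tau$-schemes $\zeta_y=(T_y,\alpha^y)$ on $X$ and $\zeta_{y_1}^{y_2}\in\mathrm{Hom}_{\mathcal C}(T_{y_1},T_{y_2})$ with (1) $T_{y_*}=T$, $\alpha^{y_*}=\mathrm{id}$; (2) $\zeta_y^y=\mathrm{id}$; (3) $\zeta_{y_2}^{y_1}=(\zeta_{y_1}^{y_2})^*$; (4) $\zeta_{y_1}^{y_2}(\tau)$ depends only on the $u\in U$ containing $(y_1,y_2)$; (5) $\zeta_{y_1}^{y_3}\le\zeta_{y_1}^{y_2}\zeta_{y_2}^{y_3}$.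 $T'_{y_1y_2}=(T_{y_1})_{\zeta_{y_1}^{y_2}}$, $T''_{y_1y_2}=(T_{y_2})_{\zeta_{y_1}^{y_2}}$. For $u\in U$, $t\in\tau$, $[u,t]$ is the set of $((y_1,x_1),(y_2,x_2))$ with $(y_1,y_2)\in u$ and $((x_1T'_{y_1y_2})\tilde\zeta_{y_1}^{y_2},x_2T''_{y_1y_2})\in(t\alpha^{y_2})^{T''_{y_1y_2}}$. -}

module Defs where

open import Data.Nat using (ℕ; _<_)
open import Data.Fin using (Fin; _≟_)
open import Data.List using (length; filter; allFin)
open import Data.Product using (Σ; ∃; ∃-syntax; _×_; _,_; proj₁)
open import Relation.Binary.PropositionalEquality using (_≡_)
open import Relation.Nullary.Decidable using (_×-dec_)

_iff_ : Set → Set → Set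
A iff B = (A → B) × (B → A)

numPaths : ∀ {n m} → (Fin n → Fin n → Fin m) → Fin m → Fin m → Fin n → Fin n → ℕ
numPaths {n} rel p q x z =
  length (filter (λ y → (rel x y ≟ p) ×-dec (rel y z ≟ q)) (allFin n))

-- Association scheme on the point set X = Fin n, whose relations are
-- labelled by Fin m:  (x,y) lies in the relation with label  rel x y.

record Scheme (n m : ℕ) : Set where
  field
    rel        : Fin n → Fin n → Fin m
    rel-surj   : ∀ r → ∃[ x ] ∃[ y ] rel x y ≡ r
    one        : Fin m
    one-diag   : ∀ x y → (rel x y ≡ one) iff (x ≡ y)
    inv        : Fin m → Fin m
    rel-inv    : ∀ x y → rel y x ≡ inv (rel x y)
    const      : Fin m → Fin m → Fin m → ℕ
    const-spec : ∀ p q x z → numPaths rel p q x z ≡ const p q (rel x z)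

record BScheme (n m : ℕ) : Set where
  field
    sch  : Scheme n m
    base : Fin n
  open Scheme sch public

module _ {n m : ℕ} (T : Scheme n m) where
  open Scheme T

  -- T'^* T' ⊆ T'  (closed subsets are nonempty)
  Closed : (Fin m → Set) → Set
  Closed S = (∃[ t ] S t)
           × (∀ p q r → S p → S q → 0 < const (inv p) q r → S r)

  -- p T' = T' p  for all p
  Normal : (Fin m → Set) → Set
  Normal S = ∀ p r → (∃[ q ] (S q × 0 < const p q r))
                     iff (∃[ q ] (S q × 0 < const q p r))

  NormalClosed : (Fin m → Set) → Set
  NormalClosed S = Closed S × Normal S

  -- y ∈ x T'
  InCoset : (Fin m → Set) → Fin n → Fin n → Set
  InCoset S x y = S (rel x y)

  -- (x₁T', x₂T') ∈ t^{T'}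
  CosetRel : (Fin m → Set) → Fin m → Fin n → Fin n → Set
  CosetRel S t x₁ x₂ =
    ∃[ x₁' ] ∃[ x₂' ] (InCoset S x₁ x₁' × InCoset S x₂ x₂' × rel x₁' x₂' ≡ t)

-- Morphisms of the category C.
-- A map  φ̃ : X/T_φ → Y/U_φ  is encoded by its graph on points:
--   Φ x y  :⇔  y ∈ (x T_φ) φ̃ .

record RawHom {n m n' m' : ℕ} (T : Scheme n m) (U : Scheme n' m') : Set₁ where
  field
    TS : Fin m → Set
    US : Fin m' → Set
    Φ  : Fin n → Fin n' → Set

module _ {n m n' m' : ℕ} {T : Scheme n m} {U : Scheme n' m'} where

  MapsInto : RawHom T U → Fin m → Fin m' → Set
  MapsInto φ t u = ∀ x₁ x₂ y₁ y₂ → CosetRel T TS t x₁ x₂ → Φ x₁ y₁ → Φ x₂ y₂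
                   → CosetRel U US u y₁ y₂
    where open RawHom φ

  star : RawHom T U → RawHom U T
  star φ = record { TS = RawHom.US φ ; US = RawHom.TS φ
                  ; Φ = λ y x → RawHom.Φ φ x y }

  HomEq : RawHom T U → RawHom T U → Set
  HomEq φ ψ = (∀ t → RawHom.TS φ t iff RawHom.TS ψ t)
            × (∀ u → RawHom.US φ u iff RawHom.US ψ u)
            × (∀ x y → RawHom.Φ φ x y iff RawHom.Φ ψ x y)

  HomLe : RawHom T U → RawHom T U → Set
  HomLe φ ψ = (∀ t → RawHom.TS φ t → RawHom.TS ψ t)
            × (∀ u → RawHom.US φ u → RawHom.US ψ u)
            × (∀ x y → RawHom.Φ φ x y → RawHom.Φ ψ x y)

  TauImage : RawHom T U → (Fin m → Set) → Fin m' → Set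
  TauImage φ P u = ∃[ t ] (P t × MapsInto φ t u)

idHom : ∀ {n m} (T : Scheme n m) → RawHom T T
idHom T = record { TS = λ t → t ≡ Scheme.one T ; US = λ t → t ≡ Scheme.one T
                 ; Φ = λ x y → Scheme.rel T x y ≡ Scheme.one T }

compose : ∀ {n m n' m' n'' m''} {T : Scheme n m} {U : Scheme n' m'}
          {V : Scheme n'' m''} → RawHom T U → RawHom U V → RawHom T V
compose {T = T} {U} {V} φ ψ = record { TS = Tφψ ; US = Vφψ ; Φ = Φφψ }
  where
  Tφψ : _ → Set
  Tφψ t = ∃[ u ] (MapsInto φ t u × MapsInto ψ u (Scheme.one V))
  Vφψ : _ → Set
  Vφψ v = ∃[ u ] (MapsInto φ (Scheme.one T) u × MapsInto ψ u v)
  Φφψ : _ → _ → Set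
  Φφψ x w' = ∃[ y ] ∃[ w ] (RawHom.Φ φ x y × RawHom.Φ ψ y w
                            × InCoset V Vφψ w w')

-- φ̃ is a based isomorphism of schemes  T//T_φ → U//U_φ
record IsBasedIso {n m n' m'} (T : BScheme n m) (U : BScheme n' m')
                  (φ : RawHom (BScheme.sch T) (BScheme.sch U)) : Set where
  open RawHom φ
  private
    T₀ = BScheme.sch T
    U₀ = BScheme.sch U
  field
    -- Φ is the graph of a well-defined map X/T_φ → Y/U_φ
    total    : ∀ x → ∃[ y ] Φ x y
    single   : ∀ x y y' → Φ x y → (Φ x y' iff InCoset U₀ US y y')
    welldef  : ∀ x x' y → InCoset T₀ TS x x' → Φ x y → Φ x' y
    inj      : ∀ x x' y → Φ x y → Φ x' y → InCoset T₀ TS x x'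
    surj     : ∀ y → ∃[ x ] Φ x y
    based    : Φ (BScheme.base T) (BScheme.base U)
    morph    : ∀ t → ∃[ u ] MapsInto φ t u
    rel-inj  : ∀ t₁ t₂ u → MapsInto φ t₁ u → MapsInto φ t₂ u
               → ∀ x₁ x₂ → CosetRel T₀ TS t₁ x₁ x₂ iff CosetRel T₀ TS t₂ x₁ x₂
    rel-surj : ∀ u → ∃[ t ] MapsInto φ t u

record Hom {n m n' m'} (T : BScheme n m) (U : BScheme n' m') : Set₁ where
  field
    raw   : RawHom (BScheme.sch T) (BScheme.sch U)
    TS-nc : NormalClosed (BScheme.sch T) (RawHom.TS raw)
    US-nc : NormalClosed (BScheme.sch U) (RawHom.US raw)
    iso   : IsBasedIso T U raw

-- τ-schemes: a τ-scheme (T',α) on X is encoded by labelling each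
-- relation of T' by its α-preimage in τ = T.

record TauScheme {n m} (T : BScheme n m) : Set where
  field
    sch      : Scheme n m
    one-eq   : Scheme.one sch ≡ BScheme.one T
    inv-eq   : ∀ p → Scheme.inv sch p ≡ BScheme.inv T p
    const-eq : ∀ p q r → Scheme.const sch p q r ≡ BScheme.const T p q r

based : ∀ {n m} {T : BScheme n m} → TauScheme T → BScheme n m
based {T = T} Z = record { sch = TauScheme.sch Z ; base = BScheme.base T }

record Action {n m n' m'} (T : BScheme n m) (U : BScheme n' m') : Set₁ where
  field
    ζ   : Fin n' → TauScheme T
    hom : (y₁ y₂ : Fin n') → Hom (based (ζ y₁)) (based (ζ y₂))
    ax1 : ∀ x₁ x₂ → Scheme.rel (TauScheme.sch (ζ (BScheme.base U))) x₁ x₂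
                    ≡ BScheme.rel T x₁ x₂
    ax2 : ∀ y → HomEq (Hom.raw (hom y y)) (idHom _)
    ax3 : ∀ y₁ y₂ → HomEq (Hom.raw (hom y₂ y₁)) (star (Hom.raw (hom y₁ y₂)))
    ax4 : ∀ y₁ y₂ y₁' y₂' → BScheme.rel U y₁ y₂ ≡ BScheme.rel U y₁' y₂'
          → ∀ (P : Fin m → Set) v
          → TauImage (Hom.raw (hom y₁ y₂)) P v iff TauImage (Hom.raw (hom y₁' y₂')) P v
    ax5 : ∀ y₁ y₂ y₃ → HomLe (Hom.raw (hom y₁ y₃))
                             (compose (Hom.raw (hom y₁ y₂)) (Hom.raw (hom y₂ y₃)))

Bracket : ∀ {n m n' m'} {T : BScheme n m} {U : BScheme n' m'} → Action T U
          → Fin m' → Fin m → (Fin n' × Fin n) → (Fin n' × Fin n) → Set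
Bracket {T = T} {U} A u t (y₁ , x₁) (y₂ , x₂) =
  BScheme.rel U y₁ y₂ ≡ u
  × ∃[ a ] ∃[ b ] (RawHom.Φ φ x₁ a
                   × InCoset T₂ (RawHom.US φ) x₂ b
                   × Scheme.rel T₂ a b ≡ t)
  where
  φ  = Hom.raw (Action.hom A y₁ y₂)
  T₂ = TauScheme.sch (Action.ζ A y₂)

IsPartition : {I C : Set} → (I → C → Set) → Set
IsPartition {I} {C} B =
    (∀ i → ∃[ c ] B i c)
  × (∀ c → ∃[ i ] B i c)
  × (∀ i j → (∃[ c ] (B i c × B j c)) → ∀ c → B i c iff B j c)

BracketFamily : ∀ {n m n' m'} {T : BScheme n m} {U : BScheme n' m'} → Action T U
                → (Fin m' × Fin m) → ((Fin n' × Fin n) × (Fin n' × Fin n)) → Set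
BracketFamily A (u , t) (p , q) = Bracket A u t p q

module Submission where

open import Defs
open import Data.Nat using (ℕ; _<_)
open import Data.Fin using (Fin; _≟_)
open import Data.List using (List; _∷_; length; filter; allFin)
open import Data.List.Membership.Propositional using (_∈_)
open import Data.List.Membership.Propositional.Properties
  using (∈-allFin; ∈-filter⁺; ∈-filter⁻; ∈-length)
open import Data.List.Relation.Unary.Any using (here)
open import Data.Product using (∃-syntax; _×_; _,_; proj₁; proj₂)
open import Relation.Binary.PropositionalEquality
  using (_≡_; refl; sym; trans; cong; subst; module ≡-Reasoning)
open import Relation.Nullary using (Dec)
open import Relation.Nullary.Decidable using (_×-dec_)

-- Two facts make
-- these sets a partition: every τ-scheme ζ_y has the intersection numbers of
-- T, so a two-step path with prescribed labels under one pair of points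
-- exists under every other pair of the same label; and the kernel T''_{y₁y₂}
-- is the image of the diagonal under ζ_{y₁}^{y₂}, hence by axiom (4)
-- depends only on the U-relation of (y₁,y₂).  Moving both the point ζ̃(x₁)
-- and x₂ within their kernel cosets along such transferred paths carries
-- membership in [u',t'] from one element of [u,t] to any other.

∃∈-nonempty : ∀ {A : Set} {xs : List A} → 0 < length xs → ∃[ x ] x ∈ xs
∃∈-nonempty {xs = x ∷ _} _ = x , here refl

module _ {n m : ℕ} (T : Scheme n m) where
  open Scheme T

  private
    via? : ∀ p q x z y → Dec (rel x y ≡ p × rel y z ≡ q)
    via? p q x z y = (rel x y ≟ p) ×-dec (rel y z ≟ q)

  path⇒numPaths-pos : ∀ {p q x y z} → rel x y ≡ p → rel y z ≡ q
                      → 0 < numPaths rel p q x z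
  path⇒numPaths-pos {p} {q} {x} {y} {z} xy yz =
    ∈-length (∈-filter⁺ (via? p q x z) (∈-allFin y) (xy , yz))

  numPaths-pos⇒path : ∀ {p q x z} → 0 < numPaths rel p q x z
                      → ∃[ y ] (rel x y ≡ p × rel y z ≡ q)
  numPaths-pos⇒path {p} {q} {x} {z} pos
    with ∃∈-nonempty {xs = filter (via? p q x z) (allFin n)} pos
  ... | y , y∈ = y , proj₂ (∈-filter⁻ (via? p q x z) {xs = allFin n} y∈)

  path⇒const-pos : ∀ {p q x y z} → rel x y ≡ p → rel y z ≡ q
                   → 0 < const p q (rel x z)
  path⇒const-pos {p} {q} {x} {z = z} xy yz =
    subst (0 <_) (const-spec p q x z) (path⇒numPaths-pos xy yz)

  rel-diagonal : ∀ x y → rel x x ≡ rel y y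
  rel-diagonal x y = trans (proj₂ (one-diag x x) refl) (sym (proj₂ (one-diag y y) refl))

  -- a_{r r* 1} > 0 is witnessed at one point and, being an intersection
  -- number, holds at every point.
  rel-from : ∀ r x → ∃[ y ] rel x y ≡ r
  rel-from r x with rel-surj r
  ... | x₀ , y₀ , x₀y₀ = proj₁ (numPaths-pos⇒path {r} {inv r} {x} {x} pos) ,
                         proj₁ (proj₂ (numPaths-pos⇒path pos))
    where
    pos : 0 < numPaths rel r (inv r) x x
    pos = subst (0 <_) (sym (const-spec r (inv r) x x))
            (subst (λ w → 0 < const r (inv r) w) (rel-diagonal x₀ x)
              (path⇒const-pos x₀y₀ (trans (rel-inv x₀ y₀) (cong inv x₀y₀))))

  module _ {S : Fin m → Set} (closed : Closed T S) where

    coset-step : ∀ {x y z} → InCoset T S y x → InCoset T S y z → InCoset T S x z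
    coset-step {x} {y} {z} yx yz =
      proj₂ closed (rel y x) (rel y z) (rel x z) yx yz
        (subst (λ w → 0 < const w (rel y z) (rel x z)) (rel-inv y x)
          (path⇒const-pos refl refl))

    coset-refl : ∀ x → InCoset T S x x
    coset-refl x with proj₁ closed
    ... | s , Ss with rel-surj s
    ... | x₀ , y₀ , x₀y₀ =
      subst S (rel-diagonal y₀ x) (coset-step (subst S (sym x₀y₀) Ss) (subst S (sym x₀y₀) Ss))

    coset-sym : ∀ {x y} → InCoset T S x y → InCoset T S y x
    coset-sym {x} xy = coset-step xy (coset-refl x)

    coset-trans : ∀ {x y z} → InCoset T S x y → InCoset T S y z → InCoset T S x z
    coset-trans xy yz = coset-step (coset-sym xy) yz

module _ {n m : ℕ} {T : BScheme n m} (Z₁ Z₂ : TauScheme T) where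
  private
    module Z₁ = Scheme (TauScheme.sch Z₁)
    module Z₂ = Scheme (TauScheme.sch Z₂)

  numPaths-transfer : ∀ p q {a b c d} → Z₁.rel a b ≡ Z₂.rel c d
                      → numPaths Z₁.rel p q a b ≡ numPaths Z₂.rel p q c d
  numPaths-transfer p q {a} {b} {c} {d} ab≡cd = begin
    numPaths Z₁.rel p q a b          ≡⟨ Z₁.const-spec p q a b ⟩
    Z₁.const p q (Z₁.rel a b)        ≡⟨ TauScheme.const-eq Z₁ p q _ ⟩
    BScheme.const T p q (Z₁.rel a b) ≡⟨ cong (BScheme.const T p q) ab≡cd ⟩
    BScheme.const T p q (Z₂.rel c d) ≡⟨ sym (TauScheme.const-eq Z₂ p q _) ⟩
    Z₂.const p q (Z₂.rel c d)        ≡⟨ sym (Z₂.const-spec p q c d) ⟩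
    numPaths Z₂.rel p q c d          ∎
    where open ≡-Reasoning

  path-transfer : ∀ {a b e c d} → Z₁.rel a b ≡ Z₂.rel c d
                  → ∃[ e' ] (Z₂.rel c e' ≡ Z₁.rel a e × Z₂.rel e' d ≡ Z₁.rel e b)
  path-transfer ab≡cd =
    numPaths-pos⇒path (TauScheme.sch Z₂)
      (subst (0 <_) (numPaths-transfer _ _ ab≡cd) (path⇒numPaths-pos (TauScheme.sch Z₁) refl refl))

module _ {n m n' m'} {T₁ : BScheme n m} {T₂ : BScheme n' m'} (φ : Hom T₁ T₂) where
  open Hom φ
  open RawHom raw
  open IsBasedIso iso
  private
    S₁ = BScheme.sch T₁
    S₂ = BScheme.sch T₂

  TS-closed : Closed S₁ TS
  TS-closed = proj₁ TS-nc

  US-closed : Closed S₂ US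
  US-closed = proj₁ US-nc

  diagonal-image⇒US : ∀ v → MapsInto raw (BScheme.one T₁) v → US v
  diagonal-image⇒US v mi
    with mi x x y y (x , x , coset-refl S₁ TS-closed x , coset-refl S₁ TS-closed x ,
                     proj₂ (BScheme.one-diag T₁ x x) refl) Φxy Φxy
    where
    x = BScheme.base T₁
    y = proj₁ (total x)
    Φxy = proj₂ (total x)
  ... | y₁ , y₂ , yy₁ , yy₂ , y₁y₂≡v =
    subst US y₁y₂≡v (coset-trans S₂ US-closed (coset-sym S₂ US-closed yy₁) yy₂)

  US⇒diagonal-image : ∀ v → US v → MapsInto raw (BScheme.one T₁) v
  US⇒diagonal-image v Uv x₁ x₂ w₁ w₂ (x₁' , x₂' , x₁x₁' , x₂x₂' , x₁'x₂'≡1) Φ₁ Φ₂ =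
    w₁ , w' , coset-refl S₂ US-closed w₁ , coset-trans S₂ US-closed w₂w₁ w₁w' , w₁w'≡v
    where
    x₁'≡x₂' : x₁' ≡ x₂'
    x₁'≡x₂' = proj₁ (BScheme.one-diag T₁ x₁' x₂') x₁'x₂'≡1
    x₂x₁ : InCoset S₁ TS x₂ x₁
    x₂x₁ = coset-trans S₁ TS-closed (subst (InCoset S₁ TS x₂) (sym x₁'≡x₂') x₂x₂')
                                     (coset-sym S₁ TS-closed x₁x₁')
    w₂w₁ : InCoset S₂ US w₂ w₁
    w₂w₁ = coset-sym S₂ US-closed (proj₁ (single x₁ w₁ w₂ Φ₁) (welldef x₂ x₁ w₂ x₂x₁ Φ₂))
    w' = proj₁ (rel-from S₂ v w₁)
    w₁w'≡v = proj₂ (rel-from S₂ v w₁)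
    w₁w' : InCoset S₂ US w₁ w'
    w₁w' = subst US (sym w₁w'≡v) Uv

module _ {n m n' m'} {T : BScheme n m} {U : BScheme n' m'} (A : Action T U) where
  open Action A
  private
    Z : Fin n' → Scheme n m
    Z y = TauScheme.sch (ζ y)

    rel : Fin n' → Fin n → Fin n → Fin m
    rel y = Scheme.rel (Z y)

    φ : (y₁ y₂ : Fin n') → RawHom (Z y₁) (Z y₂)
    φ y₁ y₂ = Hom.raw (hom y₁ y₂)

    K : Fin n' → Fin n' → Fin m → Set
    K y₁ y₂ = RawHom.US (φ y₁ y₂)

    K-closed : ∀ y₁ y₂ → Closed (Z y₂) (K y₁ y₂)
    K-closed y₁ y₂ = US-closed (hom y₁ y₂)

    iso : ∀ y₁ y₂ → IsBasedIso (based (ζ y₁)) (based (ζ y₂)) (φ y₁ y₂)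
    iso y₁ y₂ = Hom.iso (hom y₁ y₂)

  kernel-invariant : ∀ {y₁ y₂ z₁ z₂} → BScheme.rel U y₁ y₂ ≡ BScheme.rel U z₁ z₂
                     → ∀ {v} → K y₁ y₂ v → K z₁ z₂ v
  kernel-invariant {y₁} {y₂} {z₁} {z₂} same {v} Kv
    with proj₁ (ax4 y₁ y₂ z₁ z₂ same (_≡ BScheme.one T) v)
               (BScheme.one T , refl ,
                subst (λ o → MapsInto (φ y₁ y₂) o v) (TauScheme.one-eq (ζ y₁))
                      (US⇒diagonal-image (hom y₁ y₂) v Kv))
  ... | _ , refl , mi =
    diagonal-image⇒US (hom z₁ z₂) v
      (subst (λ o → MapsInto (φ z₁ z₂) o v) (sym (TauScheme.one-eq (ζ z₁))) mi)

  -- The path a → a' → b in ζ_{y₂} is lifted to c → c' → d in ζ_{z₂},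
  -- and then a' → b' → b to c' → d' → d.
  bracket-transfer : ∀ {u t u' t' c₁ c₂ d₁ d₂}
                     → Bracket A u t c₁ c₂ → Bracket A u' t' c₁ c₂
                     → Bracket A u t d₁ d₂ → Bracket A u' t' d₁ d₂
  bracket-transfer {c₁ = y₁ , x₁} {y₂ , x₂} {z₁ , w₁} {z₂ , w₂}
                   (y≡u , a , b , Φa , x₂b , ab≡t) (y≡u' , a' , b' , Φa' , x₂b' , a'b'≡t')
                   (z≡u , c , d , Φc , w₂d , cd≡t) =
    let c' , cc'≡aa' , c'd≡a'b = path-transfer (ζ y₂) (ζ z₂) {e = a'} (trans ab≡t (sym cd≡t))
        d' , c'd'≡a'b' , d'd≡b'b = path-transfer (ζ y₂) (ζ z₂) {e = b'} (sym c'd≡a'b)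
    in trans z≡u (trans (sym y≡u) y≡u') , c' , d' , Φc' cc'≡aa' , w₂d' d'd≡b'b
       , trans c'd'≡a'b' a'b'≡t'
    where
    same-U : BScheme.rel U y₁ y₂ ≡ BScheme.rel U z₁ z₂
    same-U = trans y≡u (sym z≡u)

    aa' : K y₁ y₂ (rel y₂ a a')
    aa' = proj₁ (IsBasedIso.single (iso y₁ y₂) x₁ a a' Φa) Φa'

    b'b : K y₁ y₂ (rel y₂ b' b)
    b'b = coset-trans (Z y₂) (K-closed y₁ y₂) (coset-sym (Z y₂) (K-closed y₁ y₂) x₂b') x₂b

    Φc' : ∀ {c'} → rel z₂ c c' ≡ rel y₂ a a' → RawHom.Φ (φ z₁ z₂) w₁ c'
    Φc' {c'} cc'≡aa' = proj₂ (IsBasedIso.single (iso z₁ z₂) w₁ c c' Φc)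
                             (subst (K z₁ z₂) (sym cc'≡aa') (kernel-invariant same-U aa'))

    w₂d' : ∀ {d'} → rel z₂ d' d ≡ rel y₂ b' b → InCoset (Z z₂) (K z₁ z₂) w₂ d'
    w₂d' d'd≡b'b = coset-trans (Z z₂) (K-closed z₁ z₂) w₂d
                     (coset-sym (Z z₂) (K-closed z₁ z₂)
                       (subst (K z₁ z₂) (sym d'd≡b'b) (kernel-invariant same-U b'b)))

  brackets-nonempty : ∀ i → ∃[ c ] BracketFamily A i c
  brackets-nonempty (u , t) with BScheme.rel-surj U u
  ... | y₁ , y₂ , y₁y₂≡u with Scheme.rel-surj (Z y₂) t
  ... | a , b , ab≡t with IsBasedIso.surj (iso y₁ y₂) a
  ... | x₁ , Φa = ((y₁ , x₁) , (y₂ , b)) ,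
                  y₁y₂≡u , a , b , Φa , coset-refl (Z y₂) (K-closed y₁ y₂) b , ab≡t

  brackets-cover : ∀ c → ∃[ i ] BracketFamily A i c
  brackets-cover ((y₁ , x₁) , (y₂ , x₂)) with IsBasedIso.total (iso y₁ y₂) x₁
  ... | a , Φa = (BScheme.rel U y₁ y₂ , rel y₂ a x₂) ,
                 refl , a , x₂ , Φa , coset-refl (Z y₂) (K-closed y₁ y₂) x₂ , refl

  brackets-disjoint : ∀ i j → ∃[ c ] (BracketFamily A i c × BracketFamily A j c)
                      → ∀ c → BracketFamily A i c iff BracketFamily A j c
  brackets-disjoint (_ , _) (_ , _) (_ , ci , cj) _ =
    bracket-transfer ci cj , bracket-transfer cj ci

lemma4p3 : ∀ {n m n' m'} (T : BScheme n m) (U : BScheme n' m') (ζ : Action T U)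
           → IsPartition (BracketFamily ζ)
lemma4p3 T U ζ = brackets-nonempty ζ , brackets-cover ζ , brackets-disjoint ζ
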